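{- Let $n\ge 4$ and let $G$ be a $K_{2,3}$-saturated bipartite graph with vertex classes $U$ and $U'$ each of size $n$. If $G$ has fewer than $3n-2$ edges, then: - the minimum degree of $G$ is exactly $2$; and - there exist two non-adjacent vertices $u_0\in U$ and $u_0'\in U'$, both of degree $2$.
   Context: $G$ is $K_{2,3}$-saturated if it contains no copy of $K_{2,3}$, and adding any missing edge $uu'$ with $u\in U$ and $u'\in U'$ creates a new copy of $K_{2,3}$ (one containing $uu'$). This copy may have $2$ vertices in $U$ and $3$ in $U'$, or $3$ vertices in $U$ and $2$ in $U'$. -}

module Defs where

open import Data.Nat using (ℕ; zero; suc; _+_)
open import Data.Fin using (Fin; zero; suc)
open import Data.Bool using (Bool; true; false; _∨_; _∧_)
open import Data.Sum using (_⊎_; inj₁; inj₂)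
open import Data.Product using (_×_; Σ; ∃)
open import Relation.Binary.PropositionalEquality using (_≡_; _≢_)
open import Relation.Nullary using (¬_)
open import Data.Fin using (_≟_)
open import Relation.Nullary.Decidable using (⌊_⌋)

-- A bipartite graph with vertex classes U = Fin n and U' = Fin n,
-- given by its (bi)adjacency relation: E u u' ≡ true iff uu' is an edge.
BipGraph : ℕ → Set
BipGraph n = Fin n → Fin n → Bool

b2n : Bool → ℕ
b2n true  = 1
b2n false = 0

count : ∀ {m} → (Fin m → Bool) → ℕ
count {zero}  f = 0
count {suc m} f = b2n (f zero) + count (λ i → f (suc i))

-- vertices of G: inj₁ u for u ∈ U, inj₂ u' for u' ∈ U'
Vertex : ℕ → Set
Vertex n = Fin n ⊎ Fin n

degree : ∀ {n} → BipGraph n → Vertex n → ℕ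
degree G (inj₁ u)  = count (λ u' → G u u')
degree G (inj₂ u') = count (λ u → G u u')

sumFin : ∀ {m} → (Fin m → ℕ) → ℕ
sumFin {zero}  f = 0
sumFin {suc m} f = f zero + sumFin (λ i → f (suc i))

edges : ∀ {n} → BipGraph n → ℕ
edges G = sumFin (λ u → degree G (inj₁ u))

record K23-UU' {n} (G : BipGraph n) : Set where
  field
    a b : Fin n
    x y z : Fin n
    a≢b : a ≢ b
    x≢y : x ≢ y
    x≢z : x ≢ z
    y≢z : y ≢ z
    ax : G a x ≡ true
    ay : G a y ≡ true
    az : G a z ≡ true
    bx : G b x ≡ true
    by : G b y ≡ true
    bz : G b z ≡ true

record K23-UUU' {n} (G : BipGraph n) : Set where
  field
    a b c : Fin n
    x y : Fin n
    a≢b : a ≢ b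
    a≢c : a ≢ c
    b≢c : b ≢ c
    x≢y : x ≢ y
    ax : G a x ≡ true
    bx : G b x ≡ true
    cx : G c x ≡ true
    ay : G a y ≡ true
    by : G b y ≡ true
    cy : G c y ≡ true

K23-UU'-via : ∀ {n} (G : BipGraph n) → Fin n → Fin n → Set
K23-UU'-via G u u' = Σ (K23-UU' G) λ K →
  (K23-UU'.a K ≡ u ⊎ K23-UU'.b K ≡ u) ×
  (K23-UU'.x K ≡ u' ⊎ K23-UU'.y K ≡ u' ⊎ K23-UU'.z K ≡ u')

K23-UUU'-via : ∀ {n} (G : BipGraph n) → Fin n → Fin n → Set
K23-UUU'-via G u u' = Σ (K23-UUU' G) λ K →
  (K23-UUU'.a K ≡ u ⊎ K23-UUU'.b K ≡ u ⊎ K23-UUU'.c K ≡ u) ×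
  (K23-UUU'.x K ≡ u' ⊎ K23-UUU'.y K ≡ u')

HasK23 : ∀ {n} → BipGraph n → Set
HasK23 G = K23-UU' G ⊎ K23-UUU' G

addEdge : ∀ {n} → BipGraph n → Fin n → Fin n → BipGraph n
addEdge G u u' v v' = G v v' ∨ (⌊ v ≟ u ⌋ ∧ ⌊ v' ≟ u' ⌋)

K23-saturated : ∀ {n} → BipGraph n → Set
K23-saturated {n} G =
  ¬ HasK23 G ×
  ((u u' : Fin n) → G u u' ≡ false →
     K23-UU'-via (addEdge G u u') u u' ⊎ K23-UUU'-via (addEdge G u u') u u')

module Submission where

-- Lemma 4.2.  Write n = m + 1 and e(G) for the number of edges, so that the
-- hypothesis e(G) < 3n - 2 reads e(G) ≤ 3m.  Saturation enters only through
-- its local consequence `Completes`: for every non-edge uu', either u has two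
-- neighbours x ≠ y with a common neighbour a that is adjacent to u' (the new
-- K_{2,3} has two vertices in U), or the same holds with U and U' exchanged.

open import Defs
open import Data.Nat using (ℕ; zero; suc; _+_; _*_; _∸_; _≤_; _<_; z≤n; s≤s; _≡ᵇ_; _≤?_)
open import Data.Nat.Properties
  using (+-mono-≤; +-monoʳ-≤; +-monoˡ-≤; +-comm; +-identityʳ; +-cancelˡ-≤; *-suc; *-zeroʳ;
         ≤-refl; ≤-reflexive; n≤1+n; ≤-trans; ≤-pred; m≤n+m; <⇒≱; ≰⇒>; ≡ᵇ⇒≡;
         +-commutativeSemigroup; module ≤-Reasoning)
open import Algebra.Properties.CommutativeSemigroup +-commutativeSemigroup
  using (interchange; x∙yz≈y∙xz)
open import Data.Fin using (Fin; zero; suc; _≟_)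
open import Data.Fin.Properties using (suc-injective)
open import Data.Bool using (Bool; true; false; _∧_)
open import Data.Bool.Properties using (∧-idem; ¬-not; T-≡)
open import Data.Sum using (_⊎_; inj₁; inj₂)
open import Data.Product using (_×_; _,_; Σ-syntax)
open import Data.Empty using (⊥; ⊥-elim)
open import Function.Bundles using (Equivalence)
open import Relation.Nullary using (yes; no)
open import Relation.Binary.PropositionalEquality
  using (_≡_; _≢_; ≢-sym; refl; sym; trans; cong; cong₂; subst; subst₂)
open import Data.Nat.Tactic.RingSolver using (solve)
open import Data.List using (_∷_; [])

∧-intro : ∀ {a b : Bool} → a ≡ true → b ≡ true → a ∧ b ≡ true
∧-intro refl refl = refl

sumFin-cong : ∀ {m} {f g : Fin m → ℕ} → (∀ i → f i ≡ g i) → sumFin f ≡ sumFin g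
sumFin-cong {zero}  _ = refl
sumFin-cong {suc m} h = cong₂ _+_ (h zero) (sumFin-cong (λ i → h (suc i)))

sumFin-+ : ∀ {m} (f g : Fin m → ℕ) → sumFin (λ i → f i + g i) ≡ sumFin f + sumFin g
sumFin-+ {zero}  f g = refl
sumFin-+ {suc m} f g =
  trans (cong (f zero + g zero +_) (sumFin-+ (λ i → f (suc i)) (λ i → g (suc i))))
        (interchange (f zero) (g zero) _ _)

sumFin-zero : ∀ m → sumFin {m} (λ _ → 0) ≡ 0
sumFin-zero zero    = refl
sumFin-zero (suc m) = sumFin-zero m

sumFin-one : ∀ m → sumFin {m} (λ _ → 1) ≡ m
sumFin-one zero    = refl
sumFin-one (suc m) = cong suc (sumFin-one m)

sumFin-swap : ∀ {a b} (h : Fin a → Fin b → ℕ) →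
  sumFin (λ i → sumFin (h i)) ≡ sumFin (λ j → sumFin (λ i → h i j))
sumFin-swap {zero}  {b} h = sym (sumFin-zero b)
sumFin-swap {suc a} h =
  trans (cong (sumFin (h zero) +_) (sumFin-swap (λ i → h (suc i))))
        (sym (sumFin-+ (h zero) (λ j → sumFin (λ i → h (suc i) j))))

sumFin-mono : ∀ {m} {f g : Fin m → ℕ} → (∀ i → f i ≤ g i) → sumFin f ≤ sumFin g
sumFin-mono {zero}  _ = z≤n
sumFin-mono {suc m} h = +-mono-≤ (h zero) (sumFin-mono (λ i → h (suc i)))

sumFin-≥ : ∀ {m} k {f : Fin m → ℕ} → (∀ i → k ≤ f i) → k * m ≤ sumFin f
sumFin-≥ {zero}  k _ = ≤-reflexive (*-zeroʳ k)
sumFin-≥ {suc m} k {f} h =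
  subst (_≤ sumFin f) (sym (*-suc k m)) (+-mono-≤ (h zero) (sumFin-≥ k (λ i → h (suc i))))

sumFin-≥-except : ∀ {m} k (f : Fin (suc m) → ℕ) (j : Fin (suc m)) →
  (∀ i → i ≢ j → k ≤ f i) → f j + k * m ≤ sumFin f
sumFin-≥-except k f zero h = +-monoʳ-≤ (f zero) (sumFin-≥ k (λ i → h (suc i) (λ ())))
sumFin-≥-except {suc m} k f (suc j) h =
  subst (_≤ sumFin f) rearrange
    (+-mono-≤ (h zero (λ ()))
              (sumFin-≥-except k (λ i → f (suc i)) j (λ i i≢j → h (suc i) (λ e → i≢j (suc-injective e)))))
  where
  rearrange : k + (f (suc j) + k * m) ≡ f (suc j) + k * suc m
  rearrange = trans (x∙yz≈y∙xz k (f (suc j)) (k * m)) (cong (f (suc j) +_) (sym (*-suc k m)))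

count≡sumFin : ∀ {m} (f : Fin m → Bool) → count f ≡ sumFin (λ i → b2n (f i))
count≡sumFin {zero}  f = refl
count≡sumFin {suc m} f = cong (b2n (f zero) +_) (count≡sumFin (λ i → f (suc i)))

count-cong : ∀ {m} {f g : Fin m → Bool} → (∀ i → f i ≡ g i) → count f ≡ count g
count-cong {zero}  _ = refl
count-cong {suc m} h = cong₂ _+_ (cong b2n (h zero)) (count-cong (λ i → h (suc i)))

count-false : ∀ m → count {m} (λ _ → false) ≡ 0
count-false zero    = refl
count-false (suc m) = count-false m

count-swap : ∀ {a b} (h : Fin a → Fin b → Bool) →
  sumFin (λ i → count (h i)) ≡ sumFin (λ j → count (λ i → h i j))
count-swap h =
  trans (sumFin-cong (λ i → count≡sumFin (h i)))
  (trans (sumFin-swap (λ i j → b2n (h i j)))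
         (sumFin-cong (λ j → sym (count≡sumFin (λ i → h i j)))))

count-≥1 : ∀ {m} (f : Fin m → Bool) (i : Fin m) → f i ≡ true → 1 ≤ count f
count-≥1 f zero    fi rewrite fi = s≤s z≤n
count-≥1 f (suc i) fi = ≤-trans (count-≥1 (λ j → f (suc j)) i fi) (m≤n+m _ (b2n (f zero)))

count-≥2 : ∀ {m} (f : Fin m → Bool) (i j : Fin m) → i ≢ j → f i ≡ true → f j ≡ true → 2 ≤ count f
count-≥2 f zero    zero    i≢j _  _  = ⊥-elim (i≢j refl)
count-≥2 f zero    (suc j) _   fi fj rewrite fi = s≤s (count-≥1 (λ k → f (suc k)) j fj)
count-≥2 f (suc i) zero    _   fi fj rewrite fj = s≤s (count-≥1 (λ k → f (suc k)) i fi)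
count-≥2 f (suc i) (suc j) i≢j fi fj =
  ≤-trans (count-≥2 (λ k → f (suc k)) i j (λ e → i≢j (cong suc e)) fi fj) (m≤n+m _ (b2n (f zero)))

count-witness : ∀ {m} (f : Fin m → Bool) → 1 ≤ count f → Σ[ i ∈ Fin m ] f i ≡ true
count-witness {zero}  f ()
count-witness {suc m} f pos with f zero in f0
... | true  = zero , f0
... | false = let (i , fi) = count-witness (λ j → f (suc j)) pos in suc i , fi

Escape : ∀ {m} → (Fin m → Bool) → (Fin m → Bool) → Set
Escape {m} f g = Σ[ i ∈ Fin m ] f i ≡ true × g i ≡ false

escape-suc : ∀ {m} {f g : Fin (suc m) → Bool} →
  Escape (λ i → f (suc i)) (λ i → g (suc i)) → Escape f g
escape-suc (i , fi , gi) = suc i , fi , gi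

count-escape : ∀ {m} (f g : Fin m → Bool) → count g < count f → Escape f g
count-escape {zero}  f g ()
count-escape {suc m} f g lt with f zero in f0 | g zero in g0
... | true  | false = zero , f0 , g0
... | true  | true  = escape-suc (count-escape _ _ (≤-pred lt))
... | false | true  = escape-suc (count-escape _ _ (≤-trans (n≤1+n _) lt))
... | false | false = escape-suc (count-escape _ _ lt)

is-two : ∀ k → (k ≡ᵇ 2) ≡ true → k ≡ 2
is-two k e = ≡ᵇ⇒≡ k 2 (Equivalence.from T-≡ e)

-- If every term is at least 2, then the sum plus the number of terms equal to
-- 2 is at least 3m: each term contributes at least 3 to the left-hand side.
sum+twos≥ : ∀ {m} (f : Fin m → ℕ) → (∀ i → 2 ≤ f i) → 3 * m ≤ sumFin f + count (λ i → f i ≡ᵇ 2)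
sum+twos≥ {m} f f≥2 = begin
  3 * m                                      ≤⟨ sumFin-≥ 3 (λ i → contribution (f i) (f≥2 i)) ⟩
  sumFin (λ i → f i + b2n (f i ≡ᵇ 2))         ≡⟨ sumFin-+ f (λ i → b2n (f i ≡ᵇ 2)) ⟩
  sumFin f + sumFin (λ i → b2n (f i ≡ᵇ 2))    ≡⟨ cong (sumFin f +_) (sym (count≡sumFin (λ i → f i ≡ᵇ 2))) ⟩
  sumFin f + count (λ i → f i ≡ᵇ 2)           ∎
  where
  open ≤-Reasoning
  contribution : ∀ k → 2 ≤ k → 3 ≤ k + b2n (k ≡ᵇ 2)
  contribution 1                   (s≤s ())
  contribution 2                   _        = ≤-refl
  contribution (suc (suc (suc k))) _        = s≤s (s≤s (s≤s z≤n))

transpose : ∀ {n} → BipGraph n → BipGraph n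
transpose G u' u = G u u'

-- A completion of the pair uu': a copy of K_{2,3} with parts {u, a} and
-- {x, y, u'} all of whose edges other than uu' are present in G.
record Completion {n} (G : BipGraph n) (u u' : Fin n) : Set where
  constructor completion
  field
    a x y : Fin n
    x≢y : x ≢ y
    ux  : G u x ≡ true
    uy  : G u y ≡ true
    ax  : G a x ≡ true
    ay  : G a y ≡ true
    au' : G a u' ≡ true

Completes : ∀ {n} → BipGraph n → Set
Completes {n} G = (u u' : Fin n) → G u u' ≡ false →
  Completion G u u' ⊎ Completion (transpose G) u' u

completes-transpose : ∀ {n} {G : BipGraph n} → Completes G → Completes (transpose G)
completes-transpose complete u' u nonedge with complete u u' nonedge
... | inj₁ c = inj₂ c
... | inj₂ c = inj₁ c

added-edge-avoiding-u : ∀ {n} (G : BipGraph n) {u u' p q : Fin n} →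
  p ≢ u → addEdge G u u' p q ≡ true → G p q ≡ true
added-edge-avoiding-u G {u} {u'} {p} {q} p≢u e with G p q | p ≟ u
... | true  | _       = refl
... | false | yes p≡u = ⊥-elim (p≢u p≡u)
... | false | no _    = e

added-edge-avoiding-u' : ∀ {n} (G : BipGraph n) {u u' p q : Fin n} →
  q ≢ u' → addEdge G u u' p q ≡ true → G p q ≡ true
added-edge-avoiding-u' G {u} {u'} {p} {q} q≢u' e with G p q | p ≟ u | q ≟ u'
... | true  | _     | _        = refl
... | false | no _  | _        = e
... | false | yes _ | yes q≡u' = ⊥-elim (q≢u' q≡u')
... | false | yes _ | no _     = e

-- A K_{2,3} in G + uu' with parts {s, o} ⊆ U and {p, q, r} ⊆ U', where s = u
-- and p = u', yields a completion of uu' in G: drop the edge uu' itself.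
completion-2+3 : ∀ {n} (G : BipGraph n) {u u' s o p q r : Fin n} →
  s ≡ u → p ≡ u' → s ≢ o → q ≢ p → r ≢ p → q ≢ r →
  addEdge G u u' s q ≡ true → addEdge G u u' s r ≡ true → addEdge G u u' o p ≡ true →
  addEdge G u u' o q ≡ true → addEdge G u u' o r ≡ true → Completion G u u'
completion-2+3 G {o = o} {q = q} {r = r} refl refl s≢o q≢p r≢p q≢r sq sr op oq or =
  completion o q r q≢r
    (added-edge-avoiding-u' G q≢p sq) (added-edge-avoiding-u' G r≢p sr)
    (added-edge-avoiding-u G (≢-sym s≢o) oq) (added-edge-avoiding-u G (≢-sym s≢o) or)
    (added-edge-avoiding-u G (≢-sym s≢o) op)

-- A K_{2,3} in G + uu' with parts {s, o₁, o₂} ⊆ U and {p, p'} ⊆ U', where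
-- s = u and p = u', yields a completion of u'u in the transpose.
completion-3+2 : ∀ {n} (G : BipGraph n) {u u' s o₁ o₂ p p' : Fin n} →
  s ≡ u → p ≡ u' → s ≢ o₁ → s ≢ o₂ → o₁ ≢ o₂ → p' ≢ p →
  addEdge G u u' o₁ p ≡ true → addEdge G u u' o₂ p ≡ true → addEdge G u u' o₁ p' ≡ true →
  addEdge G u u' o₂ p' ≡ true → addEdge G u u' s p' ≡ true → Completion (transpose G) u' u
completion-3+2 G {o₁ = o₁} {o₂} {p' = p'} refl refl s≢o₁ s≢o₂ o₁≢o₂ p'≢p o₁p o₂p o₁p' o₂p' sp' =
  completion p' o₁ o₂ o₁≢o₂
    (added-edge-avoiding-u G (≢-sym s≢o₁) o₁p) (added-edge-avoiding-u G (≢-sym s≢o₂) o₂p)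
    (added-edge-avoiding-u G (≢-sym s≢o₁) o₁p') (added-edge-avoiding-u G (≢-sym s≢o₂) o₂p')
    (added-edge-avoiding-u' G p'≢p sp')

completion-of-K23-UU' : ∀ {n} (G : BipGraph n) (u u' : Fin n) →
  K23-UU'-via (addEdge G u u') u u' → Completion G u u'
completion-of-K23-UU' G u u' (K , at-u , at-u') = locate at-u at-u'
  where
  open K23-UU' K
  locate : (a ≡ u ⊎ b ≡ u) → (x ≡ u' ⊎ y ≡ u' ⊎ z ≡ u') → Completion G u u'
  locate (inj₁ e) (inj₁ e')        = completion-2+3 G e e' a≢b (≢-sym x≢y) (≢-sym x≢z) y≢z ay az bx by bz
  locate (inj₁ e) (inj₂ (inj₁ e')) = completion-2+3 G e e' a≢b x≢y (≢-sym y≢z) x≢z ax az by bx bz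
  locate (inj₁ e) (inj₂ (inj₂ e')) = completion-2+3 G e e' a≢b x≢z y≢z x≢y ax ay bz bx by
  locate (inj₂ e) (inj₁ e')        = completion-2+3 G e e' (≢-sym a≢b) (≢-sym x≢y) (≢-sym x≢z) y≢z by bz ax ay az
  locate (inj₂ e) (inj₂ (inj₁ e')) = completion-2+3 G e e' (≢-sym a≢b) x≢y (≢-sym y≢z) x≢z bx bz ay ax az
  locate (inj₂ e) (inj₂ (inj₂ e')) = completion-2+3 G e e' (≢-sym a≢b) x≢z y≢z x≢y bx by az ax ay

completion-of-K23-UUU' : ∀ {n} (G : BipGraph n) (u u' : Fin n) →
  K23-UUU'-via (addEdge G u u') u u' → Completion (transpose G) u' u
completion-of-K23-UUU' G u u' (K , at-u , at-u') = locate at-u at-u'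
  where
  open K23-UUU' K
  locate : (a ≡ u ⊎ b ≡ u ⊎ c ≡ u) → (x ≡ u' ⊎ y ≡ u') → Completion (transpose G) u' u
  locate (inj₁ e)        (inj₁ e') = completion-3+2 G e e' a≢b a≢c b≢c (≢-sym x≢y) bx cx by cy ay
  locate (inj₁ e)        (inj₂ e') = completion-3+2 G e e' a≢b a≢c b≢c x≢y by cy bx cx ax
  locate (inj₂ (inj₁ e)) (inj₁ e') = completion-3+2 G e e' (≢-sym a≢b) b≢c a≢c (≢-sym x≢y) ax cx ay cy by
  locate (inj₂ (inj₁ e)) (inj₂ e') = completion-3+2 G e e' (≢-sym a≢b) b≢c a≢c x≢y ay cy ax cx bx
  locate (inj₂ (inj₂ e)) (inj₁ e') = completion-3+2 G e e' (≢-sym a≢c) (≢-sym b≢c) a≢b (≢-sym x≢y) ax bx ay by cy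
  locate (inj₂ (inj₂ e)) (inj₂ e') = completion-3+2 G e e' (≢-sym a≢c) (≢-sym b≢c) a≢b x≢y ay by ax bx cx

-- Saturation yields the local property.
saturated⇒completes : ∀ {n} (G : BipGraph n) → K23-saturated G → Completes G
saturated⇒completes G (_ , saturating) u u' nonedge with saturating u u' nonedge
... | inj₁ K = inj₁ (completion-of-K23-UU' G u u' K)
... | inj₂ K = inj₂ (completion-of-K23-UUU' G u u' K)

module DegreeBounds {m} (G : BipGraph (suc m)) (complete : Completes G) where

  open ≤-Reasoning

  degree' : Fin (suc m) → ℕ
  degree' w' = count (λ z → G z w')

  codegree : Fin (suc m) → Fin (suc m) → ℕ
  codegree w' q' = count (λ z → G z w' ∧ G z q')

  neighbour : ∀ u → Σ[ u' ∈ Fin (suc m) ] G u u' ≡ true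
  neighbour u with G u zero in u0
  ... | true  = zero , u0
  ... | false with complete u zero u0
  ...   | inj₁ c = Completion.x c , Completion.ux c
  ...   | inj₂ c = Completion.a c , Completion.au' c

  degree≥1 : ∀ u → 1 ≤ count (G u)
  degree≥1 u = let (u' , uu') = neighbour u in count-≥1 (G u) u' uu'

  -- Counting the paths w' - z - q' by their middle vertex z, which has degree
  -- ≥ 1:  Σ_q' codeg(w', q') + n ≤ e(G) + deg(w').
  codegree-sum : ∀ w' → sumFin (codegree w') + suc m ≤ edges G + degree' w'
  codegree-sum w' = begin
    sumFin (codegree w') + suc m
      ≡⟨ cong₂ _+_ (sym (count-swap paths)) (sym (sumFin-one (suc m))) ⟩
    sumFin (λ z → count (paths z)) + sumFin {suc m} (λ _ → 1)
      ≡⟨ sym (sumFin-+ {suc m} (λ z → count (paths z)) (λ _ → 1)) ⟩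
    sumFin (λ z → count (paths z) + 1)
      ≤⟨ sumFin-mono paths-through ⟩
    sumFin (λ z → count (G z) + b2n (G z w'))
      ≡⟨ sumFin-+ (λ z → count (G z)) (λ z → b2n (G z w')) ⟩
    edges G + sumFin (λ z → b2n (G z w'))
      ≡⟨ cong (edges G +_) (sym (count≡sumFin (λ z → G z w'))) ⟩
    edges G + degree' w' ∎
    where
    paths : Fin (suc m) → Fin (suc m) → Bool
    paths z q' = G z w' ∧ G z q'

    paths-through : ∀ z → count (paths z) + 1 ≤ count (G z) + b2n (G z w')
    paths-through z with G z w'
    ... | true  = ≤-refl
    ... | false = subst₂ _≤_ (cong (_+ 1) (sym (count-false (suc m))))
                             (sym (+-identityʳ (count (G z)))) (degree≥1 z)

  pendant⇒many-edges : ∀ u w' → G u w' ≡ true → count (G u) < 2 → 3 * m < edges G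
  pendant⇒many-edges u w' uw' deg<2 = +-cancelˡ-≤ (degree' w') _ _ (begin
    degree' w' + suc (3 * m)               ≡⟨ rearrange (degree' w') ⟩
    degree' w' + 2 * m + suc m             ≡⟨ cong (λ d → d + 2 * m + suc m) (sym diagonal) ⟩
    codegree w' w' + 2 * m + suc m         ≤⟨ +-monoˡ-≤ (suc m) (sumFin-≥-except 2 (codegree w') w' codegree≥2) ⟩
    sumFin (codegree w') + suc m           ≤⟨ codegree-sum w' ⟩
    edges G + degree' w'                   ≡⟨ +-comm (edges G) (degree' w') ⟩
    degree' w' + edges G                   ∎)
    where
    rearrange : ∀ d → d + suc (3 * m) ≡ d + 2 * m + suc m
    rearrange d = solve (d ∷ m ∷ [])

    diagonal : codegree w' w' ≡ degree' w'
    diagonal = count-cong (λ z → ∧-idem (G z w'))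

    not-two-neighbours : ∀ {x y} → x ≢ y → G u x ≡ true → G u y ≡ true → ⊥
    not-two-neighbours x≢y ux uy = <⇒≱ deg<2 (count-≥2 (G u) _ _ x≢y ux uy)

    only-neighbour : ∀ q' → G u q' ≡ true → q' ≡ w'
    only-neighbour q' uq' with q' ≟ w'
    ... | yes q'≡w' = q'≡w'
    ... | no  q'≢w' = ⊥-elim (not-two-neighbours q'≢w' uq' uw')

    -- The non-edge uq' cannot be completed on the side of u, so it is completed
    -- by two common neighbours x, y of q' and of u's neighbour, which is w'.
    codegree≥2 : ∀ q' → q' ≢ w' → 2 ≤ codegree w' q'
    codegree≥2 q' q'≢w' with complete u q' (¬-not (λ uq' → q'≢w' (only-neighbour q' uq')))
    ... | inj₁ c = ⊥-elim (not-two-neighbours x≢y ux uy) where open Completion c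
    ... | inj₂ c = count-≥2 (λ z → G z w' ∧ G z q') x y x≢y
                     (∧-intro (subst (λ t → G x t ≡ true) a≡w' ax) ux)
                     (∧-intro (subst (λ t → G y t ≡ true) a≡w' ay) uy)
      where
      open Completion c
      a≡w' : a ≡ w'
      a≡w' = only-neighbour a au'

  degree≥2 : edges G ≤ 3 * m → ∀ u → 2 ≤ count (G u)
  degree≥2 few u with 2 ≤? count (G u)
  ... | yes deg≥2 = deg≥2
  ... | no  deg≱2 =
    let (w' , uw') = neighbour u
    in ⊥-elim (<⇒≱ (pendant⇒many-edges u w' uw' (≰⇒> deg≱2)) few)

  degree-two : Fin (suc m) → Bool
  degree-two u = count (G u) ≡ᵇ 2

  three-of-degree-two : edges G ≤ 3 * m → 3 ≤ count degree-two
  three-of-degree-two few = +-cancelˡ-≤ (3 * m) _ _ (begin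
    3 * m + 3            ≡⟨ trans (+-comm (3 * m) 3) (sym (*-suc 3 m)) ⟩
    3 * suc m            ≤⟨ sum+twos≥ (λ u → count (G u)) (degree≥2 few) ⟩
    edges G + twos       ≤⟨ +-monoˡ-≤ twos few ⟩
    3 * m + twos         ∎)
    where
    twos : ℕ
    twos = count degree-two

  some-degree-two : edges G ≤ 3 * m → Σ[ u ∈ Fin (suc m) ] count (G u) ≡ 2
  some-degree-two few =
    let (u , two) = count-witness degree-two (≤-trans (s≤s z≤n) (three-of-degree-two few))
    in u , is-two _ two

  degree-two-avoiding : edges G ≤ 3 * m → (S : Fin (suc m) → Bool) → count S ≤ 2 →
    Σ[ u ∈ Fin (suc m) ] count (G u) ≡ 2 × S u ≡ false
  degree-two-avoiding few S |S|≤2 =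
    let (u , two , u∉S) = count-escape degree-two S (≤-trans (s≤s |S|≤2) (three-of-degree-two few))
    in u , is-two _ two , u∉S

edges-transpose : ∀ {n} (G : BipGraph n) → edges (transpose G) ≡ edges G
edges-transpose G = sym (count-swap G)

lemma4p2 : (n : ℕ) → 4 ≤ n → (G : BipGraph n) → K23-saturated G →
    edges G < 3 * n ∸ 2 →
    (((v : Vertex n) → 2 ≤ degree G v) × (Σ[ v ∈ Vertex n ] degree G v ≡ 2)) ×
    (Σ[ u₀ ∈ Fin n ] Σ[ u₀' ∈ Fin n ]
       G u₀ u₀' ≡ false × degree G (inj₁ u₀) ≡ 2 × degree G (inj₂ u₀') ≡ 2)
lemma4p2 (suc m) _ G saturated fewer =
  let (u₀ , degree-u₀) = U.some-degree-two few
      -- u₀ has only two neighbours, so a vertex of degree 2 in U' avoids them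
      (u₀' , degree-u₀' , u₀≁u₀') = U'.degree-two-avoiding fewᵀ (G u₀) (≤-reflexive degree-u₀)
  in (minimum-degree , inj₁ u₀ , degree-u₀) , u₀ , u₀' , u₀≁u₀' , degree-u₀ , degree-u₀'
  where
  few : edges G ≤ 3 * m
  few = ≤-pred (subst (edges G <_) (cong (_∸ 2) (*-suc 3 m)) fewer)

  fewᵀ : edges (transpose G) ≤ 3 * m
  fewᵀ = subst (_≤ 3 * m) (sym (edges-transpose G)) few

  complete : Completes G
  complete = saturated⇒completes G saturated

  module U  = DegreeBounds G complete
  module U' = DegreeBounds (transpose G) (completes-transpose complete)

  minimum-degree : ∀ v → 2 ≤ degree G v
  minimum-degree (inj₁ u)  = U.degree≥2 few u
  minimum-degree (inj₂ u') = U'.degree≥2 fewᵀ u'
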